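{- (i) For every natural number $n$, $\chi_d^t(F_n\star K_n)=n+3$. (ii) For every natural number $n$, $\chi_d^t(F_n\star C_{2n})=5$.
   Context: All graphs are simple and finite. $K_n$ is the complete graph and $C_{m}$ the cycle on $m$ vertices. The friendship graph $F_n$ is obtained by joining $n$ copies of the cycle $C_3$ at a common vertex. A total dominator coloring (TD-coloring) of a graph $G$ with no isolated vertex is a proper vertex coloring of $G$ in which every vertex of $G$ is adjacent to every vertex of some (other) color class. The total dominator chromatic number $\chi_d^t(G)$ is the minimum number of color classes in a TD-coloring of $G$. The neighbourhood corona $G_1\star G_2$ is the graph obtained by taking one copy of $G_1$ and $|V(G_1)|$ copies of $G_2$, and joining every neighbour (in $G_1$) of the $i$th vertex of $G_1$ to every vertex in the $i$th copy of $G_2$. -}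

module Defs where

open import Data.Nat using (ℕ; zero; suc; _<_)
open import Data.Fin using (Fin; toℕ)
open import Data.Maybe using (Maybe; just; nothing)
open import Data.Product using (Σ; _×_; _,_; ∃)
open import Data.Sum using (_⊎_; inj₁; inj₂)
open import Data.Empty using (⊥)
open import Data.Unit using (⊤)
open import Relation.Nullary using (¬_)
open import Relation.Binary.PropositionalEquality using (_≡_; _≢_)

-- A (simple) graph: a vertex type and an adjacency relation.
-- All concrete graphs below are finite, symmetric and irreflexive.
record Graph : Set₁ where
  constructor graph
  field
    V   : Set
    Adj : V → V → Set
open Graph public

K : ℕ → Graph
K n = graph (Fin n) (λ u v → u ≢ v)

-- Cycle C_m on vertices 0..m-1, i adjacent to i+1 (mod m).  (Simple for m ≥ 3.)
C : ℕ → Graph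
C m = graph (Fin m) adj
  where
  adj : Fin m → Fin m → Set
  adj u v = (suc (toℕ u) ≡ toℕ v) ⊎ (suc (toℕ v) ≡ toℕ u)
          ⊎ ((toℕ u ≡ 0) × (suc (toℕ v) ≡ m)) ⊎ ((toℕ v ≡ 0) × (suc (toℕ u) ≡ m))

-- Friendship graph F_n: center = nothing, the i-th triangle is
-- {center, just (i , 0), just (i , 1)}.
F : ℕ → Graph
F n = graph (Maybe (Fin n × Fin 2)) adj
  where
  adj : Maybe (Fin n × Fin 2) → Maybe (Fin n × Fin 2) → Set
  adj nothing nothing = ⊥
  adj nothing (just _) = ⊤
  adj (just _) nothing = ⊤
  adj (just (i , a)) (just (j , b)) = (i ≡ j) × (a ≢ b)

-- Neighbourhood corona G₁ ⋆ G₂: vertices of G₁ (inj₁) and, for every vertex i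
-- of G₁, a copy of G₂ (inj₂ (i , x)).
_⋆_ : Graph → Graph → Graph
G₁ ⋆ G₂ = graph (V G₁ ⊎ (V G₁ × V G₂)) adj
  where
  adj : V G₁ ⊎ (V G₁ × V G₂) → V G₁ ⊎ (V G₁ × V G₂) → Set
  adj (inj₁ a) (inj₁ b) = Adj G₁ a b
  adj (inj₁ a) (inj₂ (i , x)) = Adj G₁ a i
  adj (inj₂ (i , x)) (inj₁ a) = Adj G₁ i a
  adj (inj₂ (i , x)) (inj₂ (j , y)) = (i ≡ j) × Adj G₂ x y

IsProper : (G : Graph) {k : ℕ} → (V G → Fin k) → Set
IsProper G c = ∀ u v → Adj G u v → c u ≢ c v

IsTDColoring : (G : Graph) {k : ℕ} → (V G → Fin k) → Set
IsTDColoring G {k} c =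
  IsProper G c ×
  (∀ v → Σ (Fin k) λ i → (∃ λ u → c u ≡ i) × (∀ u → c u ≡ i → Adj G v u))

TDColorable : Graph → ℕ → Set
TDColorable G k = Σ (V G → Fin k) λ c → IsTDColoring G c

χdt≡ : Graph → ℕ → Set
χdt≡ G m = TDColorable G m × (∀ k → k < m → ¬ TDColorable G k)

-- Upper bound: colouring the hub of F n with one colour and the two leaves of
-- each triangle with two more is a TD-colouring (the hub dominates the class
-- of first leaves, every leaf dominates the hub).  Giving each copy of G₂ a
-- proper colouring from a disjoint palette keeps it a TD-colouring of
-- F n ⋆ G₂, since a copy vertex over v dominates the class that v dominates.
-- Lower bound: let z ℓ₀ ℓ₁ be a triangle and x a vertex of the copy over ℓ₀.
-- The class dominated by x contains no non-neighbour of x.  If z is in it,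
-- the clique {ℓ₀, ℓ₁} ∪ (an ω(G₂)-clique of the copy over z) misses its
-- colour; otherwise {z, ℓ₀} ∪ (an ω(G₂)-clique of the copy over ℓ₁) does.
-- Either way a clique on ω(G₂) + 2 vertices avoids one colour, so at least
-- ω(G₂) + 3 colours are used.
module Submission where

open import Defs
open import Data.Nat using (ℕ; zero; suc; _≤_; _<_; _+_; _*_; s≤s; parity)
open import Data.Nat.Properties using (+-comm; <⇒≱)
open import Data.Parity.Base using (Parity; 0ℙ; 1ℙ)
open import Data.Parity.Properties using (p≢p⁻¹; suc-homo-⁻¹; *-homo-*)
open import Data.Fin using (Fin; toℕ; splitAt; join; punchIn; punchOut)
  renaming (zero to fzero; suc to fsuc)
open import Data.Fin.Properties
  using (_≟_; suc-injective; splitAt-join; punchIn-injective; punchInᵢ≢i;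
         punchOut-injective; injective⇒≤; 0≢1+n)
open import Data.Maybe using (just; nothing)
open import Data.Product using (Σ; _×_; _,_; ∃)
open import Data.Sum using (_⊎_; inj₁; inj₂)
open import Data.Sum.Properties using (inj₁-injective; inj₂-injective)
open import Data.Unit using (tt)
open import Data.Empty using (⊥-elim)
open import Function using (id; _∘_)
open import Relation.Nullary using (¬_; Dec; yes; no)
open import Relation.Nullary.Decidable using (decidable-stable)
open import Relation.Binary.PropositionalEquality
  using (_≡_; _≢_; refl; sym; trans; cong; subst; ≢-sym; module ≡-Reasoning)

record Clique (G : Graph) (m : ℕ) : Set where
  field
    vertex   : Fin m → V G
    adjacent : ∀ {i j} → i ≢ j → Adj G (vertex i) (vertex j)
open Clique

χdt≡-intro : ∀ {G m} → TDColorable G m → (∀ {k} → TDColorable G k → m ≤ k) →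
             χdt≡ G m
χdt≡-intro colouring lower = colouring , λ k k<m colourable → <⇒≱ k<m (lower colourable)

missing-colour-on-clique⇒< : ∀ {G m k} {c : V G → Fin k} → IsProper G c →
                             (Q : Clique G m) (cl : Fin k) →
                             (∀ i → c (vertex Q i) ≢ cl) → m < k
missing-colour-on-clique⇒< {k = suc _} {c} proper Q cl missing =
  s≤s (injective⇒≤ colour-injective)
  where
  colour-injective : ∀ {i j} → punchOut (≢-sym (missing i)) ≡ punchOut (≢-sym (missing j)) → i ≡ j
  colour-injective {i} {j} eq = decidable-stable (i ≟ j) λ i≢j →
    proper _ _ (adjacent Q i≢j) (punchOut-injective (≢-sym (missing i)) (≢-sym (missing j)) eq)

join-injective : ∀ m n {a b : Fin m ⊎ Fin n} → join m n a ≡ join m n b → a ≡ b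
join-injective m n {a} {b} eq =
  trans (sym (splitAt-join m n a)) (trans (cong (splitAt m) eq) (splitAt-join m n b))

module _ {G₁ G₂ : Graph} where

  base : V (G₁ ⋆ G₂) → V G₁
  base (inj₁ a)       = a
  base (inj₂ (a , _)) = a

  adjacent-via-base : ∀ v b → Adj G₁ (base v) b → Adj (G₁ ⋆ G₂) v (inj₁ b)
  adjacent-via-base (inj₁ _) _ adj = adj
  adjacent-via-base (inj₂ _) _ adj = adj

  ⋆-tdColorable : ∀ {k₁ k₂} {d : V G₂ → Fin k₂} →
                  TDColorable G₁ k₁ → IsProper G₂ d → TDColorable (G₁ ⋆ G₂) (k₂ + k₁)
  ⋆-tdColorable {k₁} {k₂} {d} (c , proper , dominating) d-proper =
    join k₂ k₁ ∘ palette , proper⋆ , dominating⋆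
    where
    palette : V (G₁ ⋆ G₂) → Fin k₂ ⊎ Fin k₁
    palette (inj₁ a)       = inj₂ (c a)
    palette (inj₂ (_ , x)) = inj₁ (d x)

    palette-proper : ∀ u v → Adj (G₁ ⋆ G₂) u v → palette u ≢ palette v
    palette-proper (inj₁ a)       (inj₁ b)       adj       eq = proper a b adj (inj₂-injective eq)
    palette-proper (inj₁ _)       (inj₂ _)       _         ()
    palette-proper (inj₂ _)       (inj₁ _)       _         ()
    palette-proper (inj₂ (_ , x)) (inj₂ (_ , y)) (_ , adj) eq = d-proper x y adj (inj₁-injective eq)

    proper⋆ : IsProper (G₁ ⋆ G₂) (join k₂ k₁ ∘ palette)
    proper⋆ u v adj = palette-proper u v adj ∘ join-injective k₂ k₁

    dominating⋆ : ∀ v → Σ (Fin (k₂ + k₁)) λ i →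
                  (∃ λ u → join k₂ k₁ (palette u) ≡ i) ×
                  (∀ u → join k₂ k₁ (palette u) ≡ i → Adj (G₁ ⋆ G₂) v u)
    dominating⋆ v with dominating (base v)
    ... | i , (w , cw≡i) , dominated = join k₂ k₁ (inj₂ i) , (inj₁ w , cong (join k₂ k₁ ∘ inj₂) cw≡i) , all
      where
      all : ∀ u → join k₂ k₁ (palette u) ≡ join k₂ k₁ (inj₂ i) → Adj (G₁ ⋆ G₂) v u
      all (inj₁ b)       eq = adjacent-via-base v b (dominated b (inj₂-injective (join-injective k₂ k₁ eq)))
      all (inj₂ (_ , x)) eq with join-injective k₂ k₁ {inj₁ (d x)} {inj₂ i} eq
      ... | ()

  ⋆-triangle-clique : ∀ {m} → Clique G₁ 3 → (apex : Fin 3) → Clique G₂ m → Clique (G₁ ⋆ G₂) (2 + m)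
  ⋆-triangle-clique T a Q = record { vertex = vertex⋆ ; adjacent = adjacent⋆ }
    where
    vertex⋆ : Fin (2 + _) → V (G₁ ⋆ G₂)
    vertex⋆ fzero               = inj₁ (vertex T (punchIn a fzero))
    vertex⋆ (fsuc fzero)        = inj₁ (vertex T (punchIn a (fsuc fzero)))
    vertex⋆ (fsuc (fsuc y))     = inj₂ (vertex T a , vertex Q y)

    adjacent⋆ : ∀ {i j} → i ≢ j → Adj (G₁ ⋆ G₂) (vertex⋆ i) (vertex⋆ j)
    adjacent⋆ {fzero}          {fzero}          i≢j = ⊥-elim (i≢j refl)
    adjacent⋆ {fzero}          {fsuc fzero}     _   = adjacent T (0≢1+n ∘ punchIn-injective a _ _)
    adjacent⋆ {fzero}          {fsuc (fsuc _)}  _   = adjacent T (punchInᵢ≢i a fzero)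
    adjacent⋆ {fsuc fzero}     {fzero}          _   = adjacent T (≢-sym (0≢1+n ∘ punchIn-injective a _ _))
    adjacent⋆ {fsuc fzero}     {fsuc fzero}     i≢j = ⊥-elim (i≢j refl)
    adjacent⋆ {fsuc fzero}     {fsuc (fsuc _)}  _   = adjacent T (punchInᵢ≢i a (fsuc fzero))
    adjacent⋆ {fsuc (fsuc _)}  {fzero}          _   = adjacent T (≢-sym (punchInᵢ≢i a fzero))
    adjacent⋆ {fsuc (fsuc _)}  {fsuc fzero}     _   = adjacent T (≢-sym (punchInᵢ≢i a (fsuc fzero)))
    adjacent⋆ {fsuc (fsuc _)}  {fsuc (fsuc _)}  i≢j = refl , adjacent Q (i≢j ∘ cong (fsuc ∘ fsuc))

  ⋆-tdColorable⇒clique+3≤ : ∀ {m k} (T : Clique G₁ 3) →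
                            ¬ Adj G₁ (vertex T (fsuc fzero)) (vertex T (fsuc fzero)) →
                            Clique G₂ m → V G₂ → TDColorable (G₁ ⋆ G₂) k → m + 3 ≤ k
  ⋆-tdColorable⇒clique+3≤ {m} {k} T irreflexive Q x₀ (c , proper , dominating)
    with dominating (inj₂ (vertex T (fsuc fzero) , x₀))
  ... | cl , _ , dominated = subst (_≤ k) (+-comm 3 m) (bound (c (inj₁ z) ≟ cl))
    where
    z ℓ₀ ℓ₁ : V G₁
    z  = vertex T fzero
    ℓ₀ = vertex T (fsuc fzero)
    ℓ₁ = vertex T (fsuc (fsuc fzero))

    avoids : ∀ u → ¬ Adj (G₁ ⋆ G₂) (inj₂ (ℓ₀ , x₀)) u → c u ≢ cl
    avoids u ¬adj = ¬adj ∘ dominated u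

    other-copy-avoids : ∀ {v} y → Adj G₁ ℓ₀ v → c (inj₂ (v , y)) ≢ cl
    other-copy-avoids y adj = avoids _ λ (ℓ₀≡v , _) → irreflexive (subst (Adj G₁ ℓ₀) (sym ℓ₀≡v) adj)

    bound : Dec (c (inj₁ z) ≡ cl) → 2 + m < k
    bound (yes z∈cl) = missing-colour-on-clique⇒< proper (⋆-triangle-clique T fzero Q) cl missing
      where
      missing : ∀ i → c (vertex (⋆-triangle-clique T fzero Q) i) ≢ cl
      missing fzero           = avoids _ irreflexive
      missing (fsuc fzero)    = λ eq → proper (inj₁ z) (inj₁ ℓ₁) (adjacent T (λ ())) (trans z∈cl (sym eq))
      missing (fsuc (fsuc y)) = other-copy-avoids (vertex Q y) (adjacent T (λ ()))
    bound (no z∉cl) =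
      missing-colour-on-clique⇒< proper (⋆-triangle-clique T (fsuc (fsuc fzero)) Q) cl missing
      where
      missing : ∀ i → c (vertex (⋆-triangle-clique T (fsuc (fsuc fzero)) Q) i) ≢ cl
      missing fzero           = z∉cl
      missing (fsuc fzero)    = avoids _ irreflexive
      missing (fsuc (fsuc y)) = other-copy-avoids (vertex Q y) (adjacent T (λ ()))

F-irreflexive : ∀ {n} v → ¬ Adj (F n) v v
F-irreflexive nothing  ()
F-irreflexive (just _) (_ , a≢a) = a≢a refl

F-triangle : ∀ {n} → Clique (F (suc n)) 3
F-triangle = record { vertex = triangle ; adjacent = adjacent-triangle }
  where
  triangle : Fin 3 → V (F (suc _))
  triangle fzero               = nothing
  triangle (fsuc fzero)        = just (fzero , fzero)
  triangle (fsuc (fsuc fzero)) = just (fzero , fsuc fzero)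

  adjacent-triangle : ∀ {i j} → i ≢ j → Adj (F (suc _)) (triangle i) (triangle j)
  adjacent-triangle {fzero}               {fzero}               i≢j = ⊥-elim (i≢j refl)
  adjacent-triangle {fzero}               {fsuc fzero}          _   = tt
  adjacent-triangle {fzero}               {fsuc (fsuc fzero)}   _   = tt
  adjacent-triangle {fsuc fzero}          {fzero}               _   = tt
  adjacent-triangle {fsuc fzero}          {fsuc fzero}          i≢j = ⊥-elim (i≢j refl)
  adjacent-triangle {fsuc fzero}          {fsuc (fsuc fzero)}   _   = refl , λ ()
  adjacent-triangle {fsuc (fsuc fzero)}   {fzero}               _   = tt
  adjacent-triangle {fsuc (fsuc fzero)}   {fsuc fzero}          _   = refl , λ ()
  adjacent-triangle {fsuc (fsuc fzero)}   {fsuc (fsuc fzero)}   i≢j = ⊥-elim (i≢j refl)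

hubLeafColouring : ∀ {n} → V (F n) → Fin 3
hubLeafColouring nothing        = fzero
hubLeafColouring (just (_ , a)) = fsuc a

F-tdColorable : ∀ {n} → TDColorable (F (suc n)) 3
F-tdColorable {n} = hubLeafColouring , proper , dominating
  where
  proper : IsProper (F (suc n)) hubLeafColouring
  proper nothing  nothing  ()
  proper nothing  (just _) _         ()
  proper (just _) nothing  _         ()
  proper (just _) (just _) (_ , a≢b) = a≢b ∘ suc-injective

  dominating : ∀ v → Σ (Fin 3) λ i → (∃ λ u → hubLeafColouring u ≡ i) ×
               (∀ u → hubLeafColouring u ≡ i → Adj (F (suc n)) v u)
  dominating nothing  = fsuc fzero , (just (fzero , fzero) , refl) , λ { nothing () ; (just _) _ → tt }
  dominating (just _) = fzero , (nothing , refl) , λ { nothing _ → tt ; (just _) () }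

K-clique : ∀ {n} → Clique (K n) n
K-clique = record { vertex = id ; adjacent = id }

K-proper : ∀ {n} → IsProper (K n) id
K-proper _ _ = id

C-edge-clique : ∀ {m} → Clique (C (suc (suc m))) 2
C-edge-clique = record { vertex = edge ; adjacent = adjacent-edge }
  where
  edge : Fin 2 → Fin (suc (suc _))
  edge fzero        = fzero
  edge (fsuc fzero) = fsuc fzero

  adjacent-edge : ∀ {i j} → i ≢ j → Adj (C (suc (suc _))) (edge i) (edge j)
  adjacent-edge {fzero}      {fzero}      i≢j = ⊥-elim (i≢j refl)
  adjacent-edge {fzero}      {fsuc fzero} _   = inj₁ refl
  adjacent-edge {fsuc fzero} {fzero}      _   = inj₂ (inj₁ refl)
  adjacent-edge {fsuc fzero} {fsuc fzero} i≢j = ⊥-elim (i≢j refl)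

parityToFin : Parity → Fin 2
parityToFin 0ℙ = fzero
parityToFin 1ℙ = fsuc fzero

parityToFin-injective : ∀ {p q} → parityToFin p ≡ parityToFin q → p ≡ q
parityToFin-injective {0ℙ} {0ℙ} _ = refl
parityToFin-injective {1ℙ} {1ℙ} _ = refl

suc≡⇒parity-≢ : ∀ {a b} → suc a ≡ b → parity a ≢ parity b
suc≡⇒parity-≢ {a} refl eq = p≢p⁻¹ (parity (suc a)) (trans (sym eq) (sym (suc-homo-⁻¹ a)))

wrap-around⇒parity-≢ : ∀ n {a b} → a ≡ 0 → suc b ≡ 2 * n → parity a ≢ parity b
wrap-around⇒parity-≢ n {a} {b} a≡0 1+b≡2n eq = suc≡⇒parity-≢ 1+b≡2n (begin
  parity b       ≡⟨ eq ⟨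
  parity a       ≡⟨ cong parity a≡0 ⟩
  0ℙ             ≡⟨ *-homo-* 2 n ⟨
  parity (2 * n) ∎)
  where open ≡-Reasoning

C-even-adjacent⇒parity-≢ : ∀ n u v → Adj (C (2 * n)) u v → parity (toℕ u) ≢ parity (toℕ v)
C-even-adjacent⇒parity-≢ n u v (inj₁ 1+u≡v)                       = suc≡⇒parity-≢ 1+u≡v
C-even-adjacent⇒parity-≢ n u v (inj₂ (inj₁ 1+v≡u))                = ≢-sym (suc≡⇒parity-≢ 1+v≡u)
C-even-adjacent⇒parity-≢ n u v (inj₂ (inj₂ (inj₁ (u≡0 , 1+v≡2n)))) = wrap-around⇒parity-≢ n u≡0 1+v≡2n
C-even-adjacent⇒parity-≢ n u v (inj₂ (inj₂ (inj₂ (v≡0 , 1+u≡2n)))) = ≢-sym (wrap-around⇒parity-≢ n v≡0 1+u≡2n)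

C-even-parity-proper : ∀ n → IsProper (C (2 * n)) (parityToFin ∘ parity ∘ toℕ)
C-even-parity-proper n u v adj = C-even-adjacent⇒parity-≢ n u v adj ∘ parityToFin-injective

corollary2p5 : ((n : ℕ) → 1 ≤ n → χdt≡ (F n ⋆ K n) (n + 3))
    × ((n : ℕ) → 2 ≤ n → χdt≡ (F n ⋆ C (2 * n)) 5)
corollary2p5 = part-i , part-ii
  where
  part-i : (n : ℕ) → 1 ≤ n → χdt≡ (F n ⋆ K n) (n + 3)
  part-i (suc n) _ =
    χdt≡-intro (⋆-tdColorable F-tdColorable K-proper)
               (⋆-tdColorable⇒clique+3≤ F-triangle (F-irreflexive _) K-clique fzero)

  part-ii : (n : ℕ) → 2 ≤ n → χdt≡ (F n ⋆ C (2 * n)) 5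
  part-ii (suc (suc n)) _ =
    χdt≡-intro (⋆-tdColorable F-tdColorable (C-even-parity-proper (suc (suc n))))
               (⋆-tdColorable⇒clique+3≤ F-triangle (F-irreflexive _) C-edge-clique fzero)
  part-ii (suc zero) (s≤s ())
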